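{- Let $G$ be an eulerian graph, let $T$ be any euler circuit of $G$, and suppose $G$ has exactly $\ell$ vertices of degree congruent to $0$ mod $4$. Then $G$ has an orientable embedding with a face bounded by $T$ and at most $\ell+1$ other faces. When all vertices of $G$ have degree congruent to $2$ mod $4$, this is a bi-eulerian embedding.
   Context: Graphs are finite and may have loops and multiple edges. A graph is eulerian if it has a circuit (closed trail) using every edge and every vertex (an euler circuit). Embeddings are cellular embeddings in closed surfaces. A bi-eulerian embedding is an embedding with exactly two faces, each bounded by an euler circuit. -}

module Defs where

open import Data.Nat using (ℕ; zero; suc; _+_; _%_; _≟_)
open import Data.Nat.DivMod using (_mod_)
open import Data.Fin using (Fin; toℕ; opposite)
open import Data.Fin.Properties renaming (_≟_ to _≟ᶠ_)
open import Data.Bool using (Bool; true; false; not)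
open import Data.Product using (Σ; ∃; _×_; _,_; proj₁; proj₂)
open import Data.List using (List; length; filter; map; _++_; allFin)
open import Relation.Binary.PropositionalEquality using (_≡_)
open import Function.Definitions using (Bijective)

-- A finite graph, loops and multiple edges allowed:
-- vertices Fin n, edges Fin m, each edge e has two ends (ends e).
record Graph : Set where
  field
    n : ℕ
    m : ℕ
    ends : Fin m → Fin n × Fin n
open Graph public

-- Darts (half-edges / edge orientations): (e , false) runs from the
-- first end to the second, (e , true) the reverse.
Dart : Graph → Set
Dart G = Fin (m G) × Bool

tail : (G : Graph) → Dart G → Fin (n G)
tail G (e , false) = proj₁ (ends G e)
tail G (e , true)  = proj₂ (ends G e)

rev : (G : Graph) → Dart G → Dart G
rev G (e , b) = (e , not b)

head : (G : Graph) → Dart G → Fin (n G)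
head G d = tail G (rev G d)

allDarts : (G : Graph) → List (Dart G)
allDarts G = map (λ e → (e , false)) (allFin (m G)) ++ map (λ e → (e , true)) (allFin (m G))

-- degree = number of darts leaving v (a loop contributes 2)
deg : (G : Graph) → Fin (n G) → ℕ
deg G v = length (filter (λ d → tail G d ≟ᶠ v) (allDarts G))

numDeg0mod4 : Graph → ℕ
numDeg0mod4 G = length (filter (λ v → deg G v % 4 ≟ 0) (allFin (n G)))

_⊕_ : ∀ {k} → Fin k → ℕ → Fin k
_⊕_ {suc k} s i = (toℕ s + i) mod (suc k)

csuc : ∀ {k} → Fin k → Fin k
csuc i = i ⊕ 1

-- Euler circuit, as the cyclic sequence of its darts W 0, …, W (m-1):
-- a closed walk (head of each dart = tail of the next, cyclically),
-- using every edge exactly once, and visiting every vertex.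
record IsEulerCircuit (G : Graph) (W : Fin (m G) → Dart G) : Set where
  field
    closedWalk  : ∀ i → head G (W i) ≡ tail G (W (csuc i))
    everyEdgeOnce : Bijective _≡_ _≡_ (λ i → proj₁ (W i))
    everyVertex : ∀ v → ∃ λ i → tail G (W i) ≡ v

iter : ∀ {A : Set} → (A → A) → ℕ → A → A
iter f zero x = x
iter f (suc k) x = f (iter f k x)

-- Orientable cellular embeddings, given combinatorially by rotation
-- systems (Heffter–Edmonds): a permutation ρ of the darts, preserving
-- the tail vertex, and cyclic on the darts at each vertex.
record RotationSystem (G : Graph) : Set where
  field
    ρ      : Dart G → Dart G
    ρ-bij  : Bijective _≡_ _≡_ ρ
    ρ-local : ∀ d → tail G (ρ d) ≡ tail G d
    ρ-cyclic : ∀ d d' → tail G d ≡ tail G d' → ∃ λ k → iter ρ k d ≡ d'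
open RotationSystem public

-- face permutation: after traversing d, continue with ρ (rev d)
φ : {G : Graph} → RotationSystem G → Dart G → Dart G
φ {G} R d = ρ R (rev G d)

SameFace : {G : Graph} → RotationSystem G → Dart G → Dart G → Set
SameFace R d d' = ∃ λ k → iter (φ R) k d ≡ d'

HasFaces : {G : Graph} → RotationSystem G → ℕ → Set
HasFaces {G} R N =
  Σ (Fin N → Dart G) λ r →
    (∀ d → ∃ λ j → SameFace R (r j) d) ×
    (∀ j j' → SameFace R (r j) (r j') → j ≡ j')

Traces : {G : Graph} → RotationSystem G → Dart G → (Fin (m G) → Dart G) → Set
Traces {G} R d W = ∃ λ s → ∀ (i : ℕ) → iter (φ R) i d ≡ W (s ⊕ i)

reverseWalk : (G : Graph) → (Fin (m G) → Dart G) → Fin (m G) → Dart G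
reverseWalk G W i = rev G (W (opposite i))

FaceBoundedBy : {G : Graph} → RotationSystem G → Dart G → (Fin (m G) → Dart G) → Set
FaceBoundedBy {G} R d W = Traces R d W Data.Sum.⊎ Traces R d (reverseWalk G W)
  where import Data.Sum

BiEulerian : {G : Graph} → RotationSystem G → Set
BiEulerian {G} R =
  Σ (Fin 2 → Dart G) λ r →
    (∀ d → ∃ λ j → SameFace R (r j) d) ×
    (∀ j j' → SameFace R (r j) (r j') → j ≡ j') ×
    (∀ j → ∃ λ W → IsEulerCircuit G W × FaceBoundedBy R (r j) W)

AllDeg2mod4 : Graph → Set
AllDeg2mod4 G = ∀ v → deg G v % 4 ≡ 2

-- Number the steps of the euler circuit T by positions 0, …, m-1. Requiring T to bound a face fixes half of the
-- rotation: at the vertex visited at position i, the reverse of T i is followed by T (i+1). The other half is a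
-- permutation σ of the positions, cyclic on the visits to each vertex, and the remaining faces are exactly the
-- cycles of ψ = σ ∘ (i ↦ i-1). We build σ vertex by vertex from transpositions; each one changes the number of
-- cycles of ψ by exactly one, and by pairing up the visits to a vertex the number never grows, except by one
-- at vertices visited an even number of times, i.e. of degree 0 mod 4. Starting from the single cycle i ↦ i-1,
-- ψ ends with at most ℓ + 1 cycles; if no degree is 0 mod 4 it is a single cycle, and its face is bounded by a
-- second euler circuit.

module Submission where

open import Defs
open import Data.Nat as ℕ using (ℕ; zero; suc; _+_; _*_; _∸_; _%_; _/_; _<_; _≤_; NonZero; z≤n; s≤s)
import Data.Nat.Properties as ℕ
open import Data.Nat.Properties using (anyUpTo?)
open import Data.Nat.Induction using (<-rec)
open import Data.Nat.DivMod using (m≡m%n+[m/n]*n; %-distribˡ-+; m%n%n≡m%n; m<n⇒m%n≡m; [m+n]%n≡m%n)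
open import Data.Fin as Fin using (Fin; toℕ; fromℕ<)
import Data.Fin.Properties as Fin
open import Data.Fin.Permutation
  using (Permutation′; permutation; _⟨$⟩ʳ_; _⟨$⟩ˡ_; _∘ₚ_; _≈_; transpose; id; inverseˡ; inverseʳ)
import Data.Fin.Permutation.Components as PC
open import Data.Bool using (Bool; true; false; not; _∧_; _xor_; if_then_else_)
open import Data.Bool.Properties using (∧-zeroʳ; xor-assoc; xor-same; xor-identityʳ; not-distribˡ-xor)
open import Data.Product using (Σ; ∃; _×_; _,_; proj₁; proj₂)
open import Data.Sum using (_⊎_; inj₁; inj₂; swap) renaming (map to ⊎-map)
open import Data.List using (List; []; _∷_; _++_; length; filter; map; tabulate; allFin)
import Data.List.Properties as List
open import Data.List.Membership.Propositional using (_∈_; _∉_)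
open import Data.List.Membership.Propositional.Properties using (∈-filter⁺; ∈-filter⁻; ∈-allFin)
open import Data.List.Relation.Unary.Any using (here; there)
open import Data.List.Relation.Unary.All as All using (All)
open import Data.List.Relation.Unary.AllPairs using (_∷_)
open import Data.List.Relation.Unary.Unique.Propositional using (Unique)
import Data.List.Relation.Unary.Unique.Propositional.Properties as Unique
open import Relation.Nullary using (¬_; Dec; yes; no; does; contradiction)
open import Relation.Nullary.Decidable using (dec-true; dec-false; _→-dec_; _⊎-dec_)
open import Relation.Binary.Definitions using (tri<; tri≈; tri>)
open import Relation.Binary.PropositionalEquality
open import Function.Base using (case_of_; _∘_)
open import Function.Definitions using (Injective)
open import Function.Bundles using (_↔_; mk↔ₛ′; mk⤖; Bijection; Injection)
open import Function.Construct.Composition using (_↔-∘_)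
open import Function.Construct.Symmetry using (↔-sym)
open import Function.Properties.Inverse using (↔⇒↣; ↔⇒⤖)
open import Function.Properties.Bijection using (Bijection⇒Inverse)
open import Algebra.Properties.CommutativeMonoid.Sum ℕ.+-0-commutativeMonoid
  using (sum; sum-cong-≗; sum-permute; ∑-distrib-+)

private variable
  A B : Set
  k : ℕ


-- Iteration

iter-+ : (f : A → A) (a b : ℕ) (x : A) → iter f (a + b) x ≡ iter f a (iter f b x)
iter-+ f zero    b x = refl
iter-+ f (suc a) b x = cong f (iter-+ f a b x)

iter-cong : {f g : A → A} → (∀ x → f x ≡ g x) → ∀ j x → iter f j x ≡ iter g j x
iter-cong         f≗g zero    x = refl
iter-cong {f = f} f≗g (suc j) x = trans (cong f (iter-cong f≗g j x)) (f≗g _)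

iter-natural : {f : A → A} {g : B → B} (h : A → B) → (∀ x → h (f x) ≡ g (h x)) →
               ∀ j x → h (iter f j x) ≡ iter g j (h x)
iter-natural         h comm zero    x = refl
iter-natural {g = g} h comm (suc j) x = trans (comm _) (cong g (iter-natural h comm j x))

iter-invariant : {f : A → A} (h : A → B) → (∀ x → h (f x) ≡ h x) → ∀ j x → h (iter f j x) ≡ h x
iter-invariant h inv zero    x = refl
iter-invariant h inv (suc j) x = trans (inv _) (iter-invariant h inv j x)

iter-fixed : {f : A → A} {x : A} → f x ≡ x → ∀ j → iter f j x ≡ x
iter-fixed         fx≡x zero    = refl
iter-fixed {f = f} fx≡x (suc j) = trans (cong f (iter-fixed fx≡x j)) fx≡x

does-⇔ : {P Q : Set} → (P → Q) → (Q → P) → (P? : Dec P) (Q? : Dec Q) → does P? ≡ does Q?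
does-⇔ to from (yes p) Q? = sym (dec-true Q? (to p))
does-⇔ to from (no ¬p) Q? = sym (dec-false Q? (λ q → ¬p (from q)))

does-true : {P : Set} (P? : Dec P) → does P? ≡ true → P
does-true (yes p) _ = p

minimal : {P : ℕ → Set} → (∀ n → Dec (P n)) → ∀ n → P n → ∃ λ j → P j × (∀ i → i < j → ¬ P i)
minimal {P} P? = <-rec (λ n → P n → ∃ λ j → P j × (∀ i → i < j → ¬ P i)) λ n rec pn →
  case anyUpTo? P? n of λ where
    (yes (i , i<n , pi)) → rec i<n pi
    (no none)            → n , pn , λ i i<n pi → none (i , i<n , pi)

minimalᶠ : {P : Fin k → Set} → (∀ i → Dec (P i)) → ∀ a → P a → ∃ λ u → P u × (∀ v → P v → u Fin.≤ v)
minimalᶠ {suc k} P? a pa with P? Fin.zero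
minimalᶠ P? a          pa | yes p0 = Fin.zero , p0 , λ _ _ → z≤n
minimalᶠ P? Fin.zero   pa | no ¬p0 = contradiction pa ¬p0
minimalᶠ P? (Fin.suc a) pa | no ¬p0 with minimalᶠ (λ i → P? (Fin.suc i)) a pa
... | u , pu , least = Fin.suc u , pu , λ where
  Fin.zero    p0 → contradiction p0 ¬p0
  (Fin.suc v) pv → s≤s (least v pv)

-- Counting

count : (Fin k → Bool) → ℕ
count f = sum (λ i → if f i then 1 else 0)

count-cong : {f g : Fin k → Bool} → (∀ i → f i ≡ g i) → count f ≡ count g
count-cong f≗g = sum-cong-≗ (λ i → cong (if_then 1 else 0) (f≗g i))

count-none : {f : Fin k → Bool} → (∀ i → f i ≡ false) → count f ≡ 0
count-none {zero}  none = refl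
count-none {suc k} none rewrite none Fin.zero = count-none (λ i → none (Fin.suc i))

count-insert : {f g : Fin k → Bool} (a : Fin k) → f a ≡ true → g a ≡ false →
               (∀ i → i ≢ a → f i ≡ g i) → count f ≡ suc (count g)
count-insert Fin.zero fa ga f≗g rewrite fa | ga =
  cong suc (count-cong (λ i → f≗g (Fin.suc i) λ ()))
count-insert {g = g} (Fin.suc a) fa ga f≗g rewrite f≗g Fin.zero (λ ()) =
  trans (cong ((if g Fin.zero then 1 else 0) +_) (count-insert a fa ga λ i i≢a → f≗g (Fin.suc i) (i≢a ∘ Fin.suc-injective)))
        (ℕ.+-suc _ _)

count-pos : {f : Fin k → Bool} (a : Fin k) → f a ≡ true → 0 < count f
count-pos Fin.zero    fa rewrite fa = s≤s z≤n
count-pos (Fin.suc a) fa = ℕ.<-≤-trans (count-pos a fa) (ℕ.m≤n+m _ _)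

count≤1⇒unique : {f : Fin k → Bool} → count f ≤ 1 → ∀ a b → f a ≡ true → f b ≡ true → a ≡ b
count≤1⇒unique {k} {f} count≤1 a b fa fb with a Fin.≟ b
... | yes a≡b = a≡b
... | no  a≢b = contradiction count≤1 (ℕ.<⇒≱ (begin-strict
    1                    ≤⟨ count-pos b (trans (remove-a-other b (a≢b ∘ sym)) fb) ⟩
    count remove-a       <⟨ ℕ.n<1+n _ ⟩
    suc (count remove-a) ≡⟨ count-insert a fa remove-a-at-a (λ i i≢a → sym (remove-a-other i i≢a)) ⟨
    count f              ∎))
  where
  open ℕ.≤-Reasoning
  remove-a : Fin k → Bool
  remove-a i = if does (i Fin.≟ a) then false else f i
  remove-a-at-a : remove-a a ≡ false
  remove-a-at-a rewrite dec-true (a Fin.≟ a) refl = refl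
  remove-a-other : ∀ i → i ≢ a → remove-a i ≡ f i
  remove-a-other i i≢a rewrite dec-false (i Fin.≟ a) i≢a = refl

unique⇒count≤1 : {f : Fin k → Bool} → (∀ a b → f a ≡ true → f b ≡ true → a ≡ b) → count f ≤ 1
unique⇒count≤1 {zero}          unique = z≤n
unique⇒count≤1 {suc k} {f = f} unique with f Fin.zero in f0
... | true  = ℕ.≤-reflexive (cong suc (count-none rest-false))
  where
  rest-false : ∀ i → f (Fin.suc i) ≡ false
  rest-false i with f (Fin.suc i) in fi
  ... | true  = contradiction (unique Fin.zero (Fin.suc i) f0 fi) λ ()
  ... | false = refl
... | false = unique⇒count≤1 λ a b fa fb → Fin.suc-injective (unique (Fin.suc a) (Fin.suc b) fa fb)

record Enumeration (f : Fin k → Bool) (N : ℕ) : Set where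
  field
    at           : Fin N → Fin k
    at-injective : Injective _≡_ _≡_ at
    at-true      : ∀ j → f (at j) ≡ true
    at-onto      : ∀ i → f i ≡ true → ∃ λ j → at j ≡ i

enumerate : (f : Fin k → Bool) → Enumeration f (count f)
enumerate {zero}  f = record
  { at = λ () ; at-injective = λ { {()} } ; at-true = λ () ; at-onto = λ () }
enumerate {suc k} f with f Fin.zero in f0
... | true = record
  { at           = λ { Fin.zero → Fin.zero ; (Fin.suc j) → Fin.suc (E.at j) }
  ; at-injective = λ { {Fin.zero} {Fin.zero} _ → refl
                     ; {Fin.suc i} {Fin.suc j} e → cong Fin.suc (E.at-injective (Fin.suc-injective e)) }
  ; at-true      = λ { Fin.zero → f0 ; (Fin.suc j) → E.at-true j }
  ; at-onto      = λ { Fin.zero _ → Fin.zero , refl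
                     ; (Fin.suc i) fi → let j , e = E.at-onto i fi in Fin.suc j , cong Fin.suc e } }
  where module E = Enumeration (enumerate (f ∘ Fin.suc))
... | false = record
  { at           = Fin.suc ∘ E.at
  ; at-injective = E.at-injective ∘ Fin.suc-injective
  ; at-true      = E.at-true
  ; at-onto      = λ { Fin.zero fi → contradiction (trans (sym f0) fi) λ ()
                     ; (Fin.suc i) fi → let j , e = E.at-onto i fi in j , cong Fin.suc e } }
  where module E = Enumeration (enumerate (f ∘ Fin.suc))

length-filter-tabulate : {P : A → Set} (P? : ∀ x → Dec (P x)) (f : Fin k → A) →
                         length (filter P? (tabulate f)) ≡ count (λ i → does (P? (f i)))
length-filter-tabulate {k = zero}  P? f = refl
length-filter-tabulate {k = suc k} P? f with does (P? (f Fin.zero))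
... | true  = cong suc (length-filter-tabulate P? (f ∘ Fin.suc))
... | false = length-filter-tabulate P? (f ∘ Fin.suc)

-- Cycles of permutations

infixl 8 _^_

_^_ : Permutation′ k → ℕ → Fin k → Fin k
π ^ j = iter (π ⟨$⟩ʳ_) j

module Cycles {k : ℕ} (π : Permutation′ k) where

  ^-injective : ∀ j → Injective _≡_ _≡_ (π ^ j)
  ^-injective zero    e = e
  ^-injective (suc j) e = ^-injective j (Injection.injective (↔⇒↣ π) e)

  returns : ∀ x → ∃ λ p → (π ^ suc p) x ≡ x
  returns x with Fin.pigeonhole (ℕ.n<1+n k) (λ (i : Fin (suc k)) → (π ^ toℕ i) x)
  ... | i , j , i<j , πⁱx≡πʲx = ℕ.pred d , ^-injective (toℕ i) (begin
      (π ^ toℕ i) ((π ^ suc (ℕ.pred d)) x) ≡⟨ cong (λ t → (π ^ toℕ i) ((π ^ t) x)) (ℕ.suc-pred d) ⟩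
      (π ^ toℕ i) ((π ^ d) x)             ≡⟨ iter-+ _ (toℕ i) d x ⟨
      (π ^ (toℕ i + d)) x                  ≡⟨ cong (λ t → (π ^ t) x) (ℕ.m+[n∸m]≡n (ℕ.<⇒≤ i<j)) ⟩
      (π ^ toℕ j) x                        ≡⟨ πⁱx≡πʲx ⟨
      (π ^ toℕ i) x                        ∎)
    where
    open ≡-Reasoning
    d : ℕ
    d = toℕ j ∸ toℕ i
    instance _ = ℕ.>-nonZero (ℕ.m<n⇒0<n∸m i<j)

  below-period : ∀ {x p} → (π ^ suc p) x ≡ x → ∀ j → ∃ λ r → r < suc p × (π ^ r) x ≡ (π ^ j) x
  below-period period zero = 0 , s≤s z≤n , refl
  below-period {x} {p} period (suc j) with below-period period j
  ... | r , r<p , πʳx≡πʲx with suc r ℕ.≟ suc p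
  ...   | yes r+1≡p = 0 , s≤s z≤n , trans (sym period)
                         (trans (cong (λ t → (π ^ t) x) (sym r+1≡p)) (cong (π ⟨$⟩ʳ_) πʳx≡πʲx))
  ...   | no  r+1≢p = suc r , ℕ.≤∧≢⇒< r<p r+1≢p , cong (π ⟨$⟩ʳ_) πʳx≡πʲx

  infix 4 _∼_ _∼?_

  _∼_ : Fin k → Fin k → Set
  x ∼ y = ∃ λ j → (π ^ j) x ≡ y

  ∼-refl : ∀ {x} → x ∼ x
  ∼-refl = 0 , refl

  ∼-step : ∀ {x} → x ∼ π ⟨$⟩ʳ x
  ∼-step = 1 , refl

  ∼-trans : ∀ {x y z} → x ∼ y → y ∼ z → x ∼ z
  ∼-trans (a , refl) (b , refl) = b + a , iter-+ _ b a _

  ∼-sym : ∀ {x y} → x ∼ y → y ∼ x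
  ∼-sym {x} (j , refl) with returns x
  ... | p , period with below-period period j
  ...   | r , r<p , πʳx≡πʲx = suc p ∸ r , (begin
    (π ^ (suc p ∸ r)) ((π ^ j) x) ≡⟨ cong (π ^ (suc p ∸ r)) πʳx≡πʲx ⟨
    (π ^ (suc p ∸ r)) ((π ^ r) x) ≡⟨ iter-+ _ (suc p ∸ r) r x ⟨
    (π ^ (suc p ∸ r + r)) x       ≡⟨ cong (λ t → (π ^ t) x) (ℕ.m∸n+n≡m (ℕ.<⇒≤ r<p)) ⟩
    (π ^ suc p) x                 ≡⟨ period ⟩
    x                             ∎)
    where open ≡-Reasoning

  _∼?_ : ∀ x y → Dec (x ∼ y)
  x ∼? y with returns x
  ... | p , period with Fin.any? (λ (i : Fin (suc p)) → (π ^ toℕ i) x Fin.≟ y)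
  ...   | yes (i , πⁱx≡y) = yes (toℕ i , πⁱx≡y)
  ...   | no  none        = no λ (j , πʲx≡y) →
    let r , r<p , πʳx≡πʲx = below-period period j
    in none (fromℕ< r<p , trans (cong (λ t → (π ^ t) x) (Fin.toℕ-fromℕ< r<p)) (trans πʳx≡πʲx πʲx≡y))

  -- Each cycle is counted once, through its least element.
  IsLeast : Fin k → Set
  IsLeast u = ∀ v → u ∼ v → u Fin.≤ v

  isLeast? : ∀ u → Dec (IsLeast u)
  isLeast? u = Fin.all? (λ v → u ∼? v →-dec u Fin.≤? v)

  least-of-cycle : ∀ x → ∃ λ u → IsLeast u × u ∼ x
  least-of-cycle x with minimalᶠ (x ∼?_) x ∼-refl
  ... | u , x∼u , least = u , (λ v u∼v → least v (∼-trans x∼u u∼v)) , ∼-sym x∼u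

  least-unique : ∀ {u v} → IsLeast u → IsLeast v → u ∼ v → u ≡ v
  least-unique u-least v-least u∼v = Fin.≤-antisym (u-least _ u∼v) (v-least _ (∼-sym u∼v))

  cycles : ℕ
  cycles = count (λ u → does (isLeast? u))

  cycles≤1⇒connected : cycles ℕ.≤ 1 → ∀ x y → x ∼ y
  cycles≤1⇒connected cycles≤1 x y =
    let u , u-least , u∼x = least-of-cycle x
        v , v-least , v∼y = least-of-cycle y
        u≡v = count≤1⇒unique cycles≤1 u v (dec-true (isLeast? u) u-least) (dec-true (isLeast? v) v-least)
    in ∼-trans (∼-sym u∼x) (subst (_∼ y) (sym u≡v) v∼y)

  connected⇒cycles≤1 : (∀ x y → x ∼ y) → cycles ℕ.≤ 1
  connected⇒cycles≤1 connected = unique⇒count≤1 λ u v u-least v-least →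
    least-unique (does-true (isLeast? u) u-least) (does-true (isLeast? v) v-least) (connected u v)

  ^-periodic : ∀ .{{_ : NonZero k}} {x} → (π ^ k) x ≡ x → ∀ t → (π ^ t) x ≡ (π ^ (t % k)) x
  ^-periodic {x} πᵏx≡x t = begin
    (π ^ t) x                               ≡⟨ cong (λ s → (π ^ s) x) (m≡m%n+[m/n]*n t k) ⟩
    (π ^ (t % k + t / k * k)) x             ≡⟨ iter-+ _ (t % k) (t / k * k) x ⟩
    (π ^ (t % k)) ((π ^ (t / k * k)) x)     ≡⟨ cong (π ^ (t % k)) (multiple (t / k)) ⟩
    (π ^ (t % k)) x                         ∎
    where
    open ≡-Reasoning
    multiple : ∀ q → (π ^ (q * k)) x ≡ x
    multiple zero    = refl
    multiple (suc q) = trans (iter-+ _ k (q * k) x) (trans (cong (π ^ k) (multiple q)) πᵏx≡x)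

  module SingleCycle (connected : ∀ x y → x ∼ y) (x : Fin k) where

    private
      first-return : ∃ λ q → (π ^ suc q) x ≡ x × (∀ i → i < q → (π ^ suc i) x ≢ x)
      first-return = minimal (λ p → (π ^ suc p) x Fin.≟ x) (proj₁ (returns x)) (proj₂ (returns x))
      P : ℕ
      P = suc (proj₁ first-return)

      no-earlier-return : ∀ d → 0 < d → d < P → (π ^ d) x ≢ x
      no-earlier-return (suc d) _ (s≤s d<p) = proj₂ (proj₂ first-return) d d<p

      return-after : ∀ {a b} → a < b → (π ^ a) x ≡ (π ^ b) x → (π ^ (b ∸ a)) x ≡ x
      return-after {a} {b} a<b πᵃx≡πᵇx = ^-injective a (begin
        (π ^ a) ((π ^ (b ∸ a)) x) ≡⟨ iter-+ _ a (b ∸ a) x ⟨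
        (π ^ (a + (b ∸ a))) x     ≡⟨ cong (λ s → (π ^ s) x) (ℕ.m+[n∸m]≡n (ℕ.<⇒≤ a<b)) ⟩
        (π ^ b) x                 ≡⟨ πᵃx≡πᵇx ⟨
        (π ^ a) x                 ∎)
        where open ≡-Reasoning

      ordered : ∀ {a b} → a < b → b < P → (π ^ a) x ≢ (π ^ b) x
      ordered {a} {b} a<b b<P πᵃx≡πᵇx = no-earlier-return (b ∸ a) (ℕ.m<n⇒0<n∸m a<b)
        (ℕ.≤-<-trans (ℕ.m∸n≤m b a) b<P) (return-after a<b πᵃx≡πᵇx)

      injective-below : ∀ {a b} → a < P → b < P → (π ^ a) x ≡ (π ^ b) x → a ≡ b
      injective-below {a} {b} a<P b<P πᵃx≡πᵇx with ℕ.<-cmp a b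
      ... | tri≈ _ a≡b _ = a≡b
      ... | tri< a<b _ _ = contradiction πᵃx≡πᵇx (ordered a<b b<P)
      ... | tri> _ _ b<a = contradiction (sym πᵃx≡πᵇx) (ordered b<a a<P)

      onto-below : ∀ y → ∃ λ r → r < P × (π ^ r) x ≡ y
      onto-below y = let j , πʲx≡y = connected x y ; r , r<P , πʳx≡πʲx = below-period (proj₁ (proj₂ first-return)) j
                     in r , r<P , trans πʳx≡πʲx πʲx≡y

      index : Fin k → Fin P
      index y = fromℕ< (proj₁ (proj₂ (onto-below y)))

      index-correct : ∀ y → (π ^ toℕ (index y)) x ≡ y
      index-correct y = let r , r<P , πʳx≡y = onto-below y
                        in trans (cong (λ s → (π ^ s) x) (Fin.toℕ-fromℕ< r<P)) πʳx≡y

      P≡k : P ≡ k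
      P≡k = ℕ.≤-antisym
        (Fin.injective⇒≤ {f = λ (i : Fin P) → (π ^ toℕ i) x}
          λ e → Fin.toℕ-injective (injective-below (Fin.toℕ<n _) (Fin.toℕ<n _) e))
        (Fin.injective⇒≤ {f = index}
          λ {y} {y′} e → trans (sym (index-correct y)) (trans (cong (λ i → (π ^ toℕ i) x) e) (index-correct y′)))

    period : (π ^ k) x ≡ x
    period = subst (λ s → (π ^ s) x ≡ x) P≡k (proj₁ (proj₂ first-return))

    injective : Injective _≡_ _≡_ (λ (i : Fin k) → (π ^ toℕ i) x)
    injective {i} {j} e = Fin.toℕ-injective (injective-below (below-P i) (below-P j) e)
      where below-P : ∀ (i : Fin k) → toℕ i < P
            below-P i = subst (toℕ i <_) (sym P≡k) (Fin.toℕ<n i)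

    onto : ∀ y → ∃ λ (i : Fin k) → (π ^ toℕ i) x ≡ y
    onto y = let r , r<P , πʳx≡y = onto-below y ; r<k = subst (r <_) P≡k r<P
             in fromℕ< r<k , trans (cong (λ s → (π ^ s) x) (Fin.toℕ-fromℕ< r<k)) πʳx≡y

cycleCount : Permutation′ k → ℕ
cycleCount = Cycles.cycles

cycleCount-cong : {π ρ : Permutation′ k} → π ≈ ρ → cycleCount π ≡ cycleCount ρ
cycleCount-cong {π = π} {ρ} π≈ρ = count-cong λ u →
  does-⇔ (λ least v ρ∼v → least v (from ρ∼v)) (λ least v π∼v → least v (to π∼v)) (Π.isLeast? u) (P.isLeast? u)
  where
  module Π = Cycles π
  module P = Cycles ρ
  to : ∀ {u v} → u Π.∼ v → u P.∼ v
  to (j , e) = j , trans (sym (iter-cong π≈ρ j _)) e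
  from : ∀ {u v} → u P.∼ v → u Π.∼ v
  from (j , e) = j , trans (iter-cong π≈ρ j _) e

-- Transpositions merge or split cycles

data TransposeView (x y u : Fin k) : Set where
  at-x  : u ≡ x →          PC.transpose x y u ≡ y → TransposeView x y u
  at-y  : u ≢ x → u ≡ y → PC.transpose x y u ≡ x → TransposeView x y u
  other : u ≢ x → u ≢ y → PC.transpose x y u ≡ u → TransposeView x y u

transpose-view : (x y u : Fin k) → TransposeView x y u
transpose-view x y u with u Fin.≟ x | u Fin.≟ y
... | yes u≡x | _       = at-x u≡x (by-cases u≡x)
  where by-cases : u ≡ x → PC.transpose x y u ≡ y
        by-cases u≡x rewrite dec-true (u Fin.≟ x) u≡x = refl
... | no  u≢x | yes u≡y = at-y u≢x u≡y (by-cases u≢x u≡y)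
  where by-cases : u ≢ x → u ≡ y → PC.transpose x y u ≡ x
        by-cases u≢x u≡y rewrite dec-false (u Fin.≟ x) u≢x | dec-true (u Fin.≟ y) u≡y = refl
... | no  u≢x | no  u≢y = other u≢x u≢y (by-cases u≢x u≢y)
  where by-cases : u ≢ x → u ≢ y → PC.transpose x y u ≡ u
        by-cases u≢x u≢y rewrite dec-false (u Fin.≟ x) u≢x | dec-false (u Fin.≟ y) u≢y = refl

transpose-preserves : (f : Fin k → A) {x y : Fin k} → f x ≡ f y → ∀ u → f (PC.transpose x y u) ≡ f u
transpose-preserves f {x} {y} fx≡fy u with transpose-view x y u
... | at-x  refl e   = trans (cong f e) (sym fx≡fy)
... | at-y  _ refl e = trans (cong f e) fx≡fy
... | other _ _ e    = cong f e

transpose-other : {x y u : Fin k} → u ≢ x → u ≢ y → PC.transpose x y u ≡ u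
transpose-other {x = x} {y} {u} u≢x u≢y with transpose-view x y u
... | at-x  u≡x _   = contradiction u≡x u≢x
... | at-y  _ u≡y _ = contradiction u≡y u≢y
... | other _ _ e   = e

transpose-x : (x y : Fin k) → PC.transpose x y x ≡ y
transpose-x x y with transpose-view x y x
... | at-x  _ e     = e
... | at-y  x≢x _ _ = contradiction refl x≢x
... | other x≢x _ _ = contradiction refl x≢x

transpose-y : (x y : Fin k) → PC.transpose x y y ≡ x
transpose-y x y with transpose-view x y y
... | at-x  y≡x e   = trans e y≡x
... | at-y  _ _ e   = e
... | other _ y≢y _ = contradiction refl y≢y

transpose-involutive : (x y u : Fin k) → PC.transpose x y (PC.transpose x y u) ≡ u
transpose-involutive x y u with transpose-view x y u
... | at-x  refl e   = trans (cong (PC.transpose x y) e) (transpose-y x y)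
... | at-y  _ refl e = trans (cong (PC.transpose x y) e) (transpose-x x y)
... | other _ _ e    = trans (cong (PC.transpose x y) e) e

module Merge (π : Permutation′ k) {x y : Fin k} (x≁y : ¬ Cycles._∼_ π x y) where

  π′ : Permutation′ k
  π′ = π ∘ₚ transpose x y

  open Cycles π
  open Cycles π′ using () renaming
    (_∼_ to _∼′_; ∼-refl to ∼′-refl; ∼-trans to ∼′-trans; ∼-sym to ∼′-sym;
     IsLeast to IsLeast′; isLeast? to isLeast′?)

  Joined : Fin k → Set
  Joined z = x ∼ z ⊎ y ∼ z

  private
    agrees-until-y : ∀ j → x ∼′ y ⊎ (π′ ^ j) x ≡ (π ^ j) x
    agrees-until-y zero = inj₂ refl
    agrees-until-y (suc j) with agrees-until-y j
    ... | inj₁ x∼′y = inj₁ x∼′y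
    ... | inj₂ e with transpose-view x y ((π ^ suc j) x)
    ...   | at-x _ τ≡y    = inj₁ (suc j , trans (cong (PC.transpose x y ∘ (π ⟨$⟩ʳ_)) e) τ≡y)
    ...   | at-y _ πx≡y _ = contradiction (suc j , πx≡y) x≁y
    ...   | other _ _ τ≡  = inj₂ (trans (cong (PC.transpose x y ∘ (π ⟨$⟩ʳ_)) e) τ≡)

  x∼′y : x ∼′ y
  x∼′y with returns x
  ... | p , period with agrees-until-y p
  ...   | inj₁ joined = joined
  ...   | inj₂ e    = suc p , (begin
    PC.transpose x y (π ⟨$⟩ʳ (π′ ^ p) x) ≡⟨ cong (PC.transpose x y ∘ (π ⟨$⟩ʳ_)) e ⟩
    PC.transpose x y ((π ^ suc p) x)    ≡⟨ cong (PC.transpose x y) period ⟩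
    PC.transpose x y x                  ≡⟨ transpose-x x y ⟩
    y                                   ∎)
    where open ≡-Reasoning

  private
    x∼′-step : ∀ {w} → x ∼′ w → x ∼′ π ⟨$⟩ʳ w
    x∼′-step {w} x∼′w with transpose-view x y (π ⟨$⟩ʳ w)
    ... | at-x πw≡x _   = subst (x ∼′_) (sym πw≡x) ∼′-refl
    ... | at-y _ πw≡y _ = subst (x ∼′_) (sym πw≡y) x∼′y
    ... | other _ _ τ≡  = ∼′-trans x∼′w (1 , τ≡)

    x∼′-steps : ∀ {w} j → x ∼′ w → x ∼′ (π ^ j) w
    x∼′-steps zero    x∼′w = x∼′w
    x∼′-steps (suc j) x∼′w = x∼′-step (x∼′-steps j x∼′w)

  Joined⇒x∼′ : ∀ {z} → Joined z → x ∼′ z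
  Joined⇒x∼′ (inj₁ (j , refl)) = x∼′-steps j ∼′-refl
  Joined⇒x∼′ (inj₂ (j , refl)) = x∼′-steps j x∼′y

  joined-connected : ∀ {u v} → Joined u → Joined v → u ∼′ v
  joined-connected Ju Jv = ∼′-trans (∼′-sym (Joined⇒x∼′ Ju)) (Joined⇒x∼′ Jv)

  joined-closed : ∀ {u v} → Joined u → u ∼′ v → Joined v
  joined-closed Ju (j , refl) = steps j Ju
    where
    step : ∀ {w} → Joined w → Joined (π′ ⟨$⟩ʳ w)
    step {w} Jw with transpose-view x y (π ⟨$⟩ʳ w)
    ... | at-x _ τ≡y  = subst Joined (sym τ≡y) (inj₂ ∼-refl)
    ... | at-y _ _ τ≡x = subst Joined (sym τ≡x) (inj₁ ∼-refl)
    ... | other _ _ τ≡ = subst Joined (sym τ≡) (⊎-map (λ s → ∼-trans s ∼-step) (λ s → ∼-trans s ∼-step) Jw)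
    steps : ∀ {w} j → Joined w → Joined ((π′ ^ j) w)
    steps zero    Jw = Jw
    steps (suc j) Jw = step (steps j Jw)

  unaffected : ∀ {z} → ¬ Joined z → ∀ j → (π′ ^ j) z ≡ (π ^ j) z
  unaffected ¬Jz zero    = refl
  unaffected ¬Jz (suc j) = trans (cong (π′ ⟨$⟩ʳ_) (unaffected ¬Jz j))
    (transpose-other (λ πz≡x → ¬Jz (inj₁ (∼-sym (suc j , πz≡x))))
                     (λ πz≡y → ¬Jz (inj₂ (∼-sym (suc j , πz≡y)))))

  private
    Joined? : ∀ z → Dec (Joined z)
    Joined? z = x ∼? z ⊎-dec y ∼? z

    Joined-∼ : ∀ {u v} → Joined u → u ∼ v → Joined v
    Joined-∼ Ju u∼v = ⊎-map (λ s → ∼-trans s u∼v) (λ s → ∼-trans s u∼v) Ju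

    unaffected-∼ : ∀ {u v} → ¬ Joined u → u ∼′ v → u ∼ v
    unaffected-∼ ¬Ju (j , e) = j , trans (sym (unaffected ¬Ju j)) e

    unaffected-∼′ : ∀ {u v} → ¬ Joined u → u ∼ v → u ∼′ v
    unaffected-∼′ ¬Ju (j , e) = j , trans (unaffected ¬Ju j) e

    -- lo and hi are the least elements of the two merged cycles; only hi stops being least.
    module Leaders (lo hi : Fin k) (lo-least : IsLeast lo) (hi-least : IsLeast hi) (lo<hi : lo Fin.< hi)
                   (Jlo : Joined lo) (Jhi : Joined hi) (cover : ∀ {u} → Joined u → lo ∼ u ⊎ hi ∼ u) where

      hi-not-least′ : ¬ IsLeast′ hi
      hi-not-least′ least′ = ℕ.<⇒≱ lo<hi (least′ lo (joined-connected Jhi Jlo))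

      lo-least′ : IsLeast′ lo
      lo-least′ v lo∼′v with cover (joined-closed Jlo lo∼′v)
      ... | inj₁ lo∼v = lo-least v lo∼v
      ... | inj₂ hi∼v = ℕ.≤-trans (ℕ.<⇒≤ lo<hi) (hi-least v hi∼v)

      least⇒least′ : ∀ {u} → u ≢ hi → IsLeast u → IsLeast′ u
      least⇒least′ {u} u≢hi u-least with Joined? u
      ... | no ¬Ju = λ v u∼′v → u-least v (unaffected-∼ ¬Ju u∼′v)
      ... | yes Ju with cover Ju
      ...   | inj₁ lo∼u = subst IsLeast′ (least-unique lo-least u-least lo∼u) lo-least′
      ...   | inj₂ hi∼u = contradiction (sym (least-unique hi-least u-least hi∼u)) u≢hi

      least′⇒least : ∀ {u} → IsLeast′ u → IsLeast u
      least′⇒least {u} least′ v u∼v with Joined? u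
      ... | yes Ju = least′ v (joined-connected Ju (Joined-∼ Ju u∼v))
      ... | no ¬Ju = least′ v (unaffected-∼′ ¬Ju u∼v)

      one-fewer : cycleCount π ≡ suc (cycleCount π′)
      one-fewer = count-insert hi (dec-true (isLeast? hi) hi-least) (dec-false (isLeast′? hi) hi-not-least′)
        λ u u≢hi → does-⇔ (least⇒least′ u≢hi) least′⇒least (isLeast? u) (isLeast′? u)

  cycleCount-merge : cycleCount π ≡ suc (cycleCount π′)
  cycleCount-merge with least-of-cycle x | least-of-cycle y
  ... | a , a-least , a∼x | b , b-least , b∼y with Fin.<-cmp a b
  ...   | tri< a<b _ _  = Leaders.one-fewer a b a-least b-least a<b (inj₁ (∼-sym a∼x)) (inj₂ (∼-sym b∼y))
                            (⊎-map (∼-trans a∼x) (∼-trans b∼y))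
  ...   | tri≈ _ refl _ = contradiction (∼-trans (∼-sym a∼x) b∼y) x≁y
  ...   | tri> _ _ b<a  = Leaders.one-fewer b a b-least a-least b<a (inj₂ (∼-sym b∼y)) (inj₁ (∼-sym a∼x))
                            (swap ∘ ⊎-map (∼-trans a∼x) (∼-trans b∼y))

module Split (π : Permutation′ k) {x y : Fin k} (x≢y : x ≢ y) (x∼y : Cycles._∼_ π x y) where

  π′ : Permutation′ k
  π′ = π ∘ₚ transpose x y

  open Cycles π

  private
    first-visit : ∃ λ j → (π ^ j) x ≡ y × (∀ i → i < j → (π ^ i) x ≢ y)
    first-visit = minimal (λ j → (π ^ j) x Fin.≟ y) (proj₁ x∼y) (proj₂ x∼y)

    j : ℕ
    j = proj₁ first-visit

    πʲx≡y : (π ^ j) x ≡ y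
    πʲx≡y = proj₁ (proj₂ first-visit)

    before-j : ∀ i → i < j → (π ^ i) x ≢ y
    before-j = proj₂ (proj₂ first-visit)

    0<j : 0 < j
    0<j with j | πʲx≡y
    ... | zero  | x≡y = contradiction x≡y x≢y
    ... | suc _ | _   = s≤s z≤n

    Arc : Fin k → Set
    Arc u = ∃ λ i → i < j × (π ^ i) x ≡ u

    no-return : ∀ {i} → suc i < j → (π ^ suc i) x ≢ x
    no-return {i} i+1<j πⁱ⁺¹x≡x = before-j (j ∸ suc i) (ℕ.∸-monoʳ-< {o = 0} (s≤s z≤n) (ℕ.<⇒≤ i+1<j)) (begin
      (π ^ (j ∸ suc i)) x                ≡⟨ cong (π ^ (j ∸ suc i)) πⁱ⁺¹x≡x ⟨
      (π ^ (j ∸ suc i)) ((π ^ suc i) x)  ≡⟨ iter-+ _ (j ∸ suc i) (suc i) x ⟨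
      (π ^ (j ∸ suc i + suc i)) x        ≡⟨ cong (λ t → (π ^ t) x) (ℕ.m∸n+n≡m (ℕ.<⇒≤ i+1<j)) ⟩
      (π ^ j) x                          ≡⟨ πʲx≡y ⟩
      y                                  ∎)
      where open ≡-Reasoning

    reaches-y : ∀ {i} → i ≡ j → (π ^ i) x ≡ y
    reaches-y refl = πʲx≡y

    -- π′ closes the arc x, π x, …, π^(j-1) x into a cycle of its own, which misses y.
    arc-step : ∀ {u} → Arc u → Arc (π′ ⟨$⟩ʳ u)
    arc-step (i , i<j , refl) with transpose-view x y ((π ^ suc i) x) | ℕ.m≤n⇒m<n∨m≡n i<j
    ... | at-y _ _ τ≡x      | _           = 0 , 0<j , sym τ≡x
    ... | at-x πx≡x _       | inj₁ i+1<j  = contradiction πx≡x (no-return i+1<j)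
    ... | at-x πx≡x _       | inj₂ i+1≡j  = contradiction (trans (sym πx≡x) (reaches-y i+1≡j)) x≢y
    ... | other _ πx≢y τ≡   | inj₁ i+1<j  = suc i , i+1<j , sym τ≡
    ... | other _ πx≢y _    | inj₂ i+1≡j  = contradiction (reaches-y i+1≡j) πx≢y

    y∉Arc : ¬ Arc y
    y∉Arc (i , i<j , πⁱx≡y) = before-j i i<j πⁱx≡y

  separated : ¬ Cycles._∼_ π′ x y
  separated (t , π′ᵗx≡y) = y∉Arc (subst Arc π′ᵗx≡y (arc-steps t))
    where
    arc-steps : ∀ t → Arc ((π′ ^ t) x)
    arc-steps zero    = 0 , 0<j , refl
    arc-steps (suc t) = arc-step (arc-steps t)

  cycleCount-split : cycleCount π′ ≡ suc (cycleCount π)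
  cycleCount-split = trans (Merge.cycleCount-merge π′ separated)
    (cong suc (cycleCount-cong λ u → transpose-involutive x y (π ⟨$⟩ʳ u)))

-- Cyclic arithmetic on positions

toℕ-⊕ : .{{_ : NonZero k}} (s : Fin k) (j : ℕ) → toℕ (s ⊕ j) ≡ (toℕ s + j) % k
toℕ-⊕ {suc k} s j = Fin.toℕ-fromℕ< _

private
  %-absorbˡ : ∀ a b d .{{_ : NonZero d}} → (a % d + b) % d ≡ (a + b) % d
  %-absorbˡ a b d = begin
    (a % d + b) % d           ≡⟨ %-distribˡ-+ (a % d) b d ⟩
    (a % d % d + b % d) % d   ≡⟨ cong (λ t → (t + b % d) % d) (m%n%n≡m%n a d) ⟩
    (a % d + b % d) % d       ≡⟨ %-distribˡ-+ a b d ⟨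
    (a + b) % d               ∎
    where open ≡-Reasoning

⊕-+ : (s : Fin k) (i j : ℕ) → (s ⊕ i) ⊕ j ≡ s ⊕ (i + j)
⊕-+ {suc k} s i j = Fin.toℕ-injective (begin
  toℕ ((s ⊕ i) ⊕ j)               ≡⟨ toℕ-⊕ (s ⊕ i) j ⟩
  (toℕ (s ⊕ i) + j) % suc k       ≡⟨ cong (λ t → (t + j) % suc k) (toℕ-⊕ s i) ⟩
  ((toℕ s + i) % suc k + j) % suc k ≡⟨ %-absorbˡ (toℕ s + i) j (suc k) ⟩
  (toℕ s + i + j) % suc k         ≡⟨ cong (_% suc k) (ℕ.+-assoc (toℕ s) i j) ⟩
  (toℕ s + (i + j)) % suc k       ≡⟨ toℕ-⊕ s (i + j) ⟨
  toℕ (s ⊕ (i + j))               ∎)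
  where open ≡-Reasoning

⊕-toℕ : {z : Fin k} → toℕ z ≡ 0 → ∀ i → z ⊕ toℕ i ≡ i
⊕-toℕ {suc k} {z} z≡0 i = Fin.toℕ-injective (begin
  toℕ (z ⊕ toℕ i)           ≡⟨ toℕ-⊕ z (toℕ i) ⟩
  (toℕ z + toℕ i) % suc k   ≡⟨ cong (λ t → (t + toℕ i) % suc k) z≡0 ⟩
  toℕ i % suc k             ≡⟨ m<n⇒m%n≡m (Fin.toℕ<n i) ⟩
  toℕ i                     ∎)
  where open ≡-Reasoning

⊕-zero : (s : Fin k) → s ⊕ 0 ≡ s
⊕-zero {suc k} s = Fin.toℕ-injective (trans (toℕ-⊕ s 0)
  (trans (cong (_% suc k) (ℕ.+-identityʳ (toℕ s))) (m<n⇒m%n≡m (Fin.toℕ<n s))))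

⊕-period : (s : Fin k) → s ⊕ k ≡ s
⊕-period {suc k} s = Fin.toℕ-injective (trans (toℕ-⊕ s (suc k))
  (trans ([m+n]%n≡m%n (toℕ s) (suc k)) (m<n⇒m%n≡m (Fin.toℕ<n s))))

iter-csuc : (s : Fin k) (j : ℕ) → iter csuc j s ≡ s ⊕ j
iter-csuc s zero    = sym (⊕-zero s)
iter-csuc s (suc j) = trans (cong csuc (iter-csuc s j)) (trans (⊕-+ s j 1) (cong (s ⊕_) (ℕ.+-comm j 1)))

cpred : Fin k → Fin k
cpred {suc k} i = i ⊕ k

csuc-cpred : (i : Fin k) → csuc (cpred i) ≡ i
csuc-cpred {suc k} i = trans (⊕-+ i k 1) (trans (cong (i ⊕_) (ℕ.+-comm k 1)) (⊕-period i))

cpred-csuc : (i : Fin k) → cpred (csuc i) ≡ i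
cpred-csuc {suc k} i = trans (⊕-+ i 1 k) (⊕-period i)

cpredₚ : Permutation′ k
cpredₚ = permutation cpred csuc cpred-csuc csuc-cpred

cpred-connected : (a b : Fin k) → Cycles._∼_ cpredₚ a b
cpred-connected {suc k} a b = ∼-trans (∼-sym (from-zero a)) (from-zero b)
  where
  open Cycles cpredₚ
  from-zero : ∀ a → Fin.zero ∼ a
  from-zero a = subst (Fin.zero ∼_) (trans (iter-csuc Fin.zero (toℕ a)) (⊕-toℕ refl a)) (go (toℕ a))
    where
    go : ∀ j → Fin.zero ∼ iter csuc j Fin.zero
    go zero    = ∼-refl
    go (suc j) = ∼-trans (go j) (∼-sym (1 , cpred-csuc _))

-- Permutations cyclic on the fibres of a map

isEven : ℕ → Bool
isEven zero          = true
isEven (suc zero)    = false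
isEven (suc (suc n)) = isEven n

<-suc-≢ : ∀ {n} {v i : Fin n} {c} → toℕ v ≡ c → toℕ i < suc c → i ≢ v → toℕ i < c
<-suc-≢ v≡c i<1+c i≢v = ℕ.≤∧≢⇒< (ℕ.≤-pred i<1+c) (λ i≡c → i≢v (Fin.toℕ-injective (trans i≡c (sym v≡c))))

private
  below-suc : ∀ {n} {v : Fin n} {c} → toℕ v ≡ c → ∀ i → i ≢ v →
              does (toℕ i ℕ.<? suc c) ≡ does (toℕ i ℕ.<? c)
  below-suc v≡c i i≢v =
    does-⇔ (λ i<1+c → <-suc-≢ v≡c i<1+c i≢v) ℕ.m<n⇒m<1+n (toℕ i ℕ.<? _) (toℕ i ℕ.<? _)

count-below-suc : ∀ {n} (e : Fin n → Bool) {v : Fin n} {c : ℕ} → toℕ v ≡ c →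
                  count (λ i → does (toℕ i ℕ.<? suc c) ∧ e i) ≡
                  (if e v then 1 else 0) + count (λ i → does (toℕ i ℕ.<? c) ∧ e i)
count-below-suc e {v} {c} v≡c with e v in ev
... | true  = count-insert v (cong₂ _∧_ (dec-true (toℕ v ℕ.<? suc c) (s≤s (ℕ.≤-reflexive v≡c))) ev)
                             (cong (_∧ e v) (dec-false (toℕ v ℕ.<? c) (ℕ.<-irrefl v≡c)))
                             (λ i i≢v → cong (_∧ e i) (below-suc v≡c i i≢v))
... | false = count-cong λ i → unchanged i
  where
  unchanged : ∀ i → does (toℕ i ℕ.<? suc c) ∧ e i ≡ does (toℕ i ℕ.<? c) ∧ e i
  unchanged i with i Fin.≟ v
  ... | yes refl rewrite ev = trans (∧-zeroʳ _) (sym (∧-zeroʳ _))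
  ... | no  i≢v  = cong (_∧ e i) (below-suc v≡c i i≢v)

module Fibres {k n : ℕ} (vis : Fin k → Fin n) where

  fibre : Fin n → List (Fin k)
  fibre v = filter (λ u → vis u Fin.≟ v) (allFin k)

  fibreSize : Fin n → ℕ
  fibreSize v = length (fibre v)

  ∈-fibre⁺ : ∀ {u v} → vis u ≡ v → u ∈ fibre v
  ∈-fibre⁺ {u} {v} = ∈-filter⁺ (λ u → vis u Fin.≟ v) (∈-allFin u)

  ∈-fibre⁻ : ∀ {u v} → u ∈ fibre v → vis u ≡ v
  ∈-fibre⁻ {u} {v} u∈ = proj₂ (∈-filter⁻ (λ u → vis u Fin.≟ v) {xs = allFin k} u∈)

  fibre-unique : ∀ v → Unique (fibre v)
  fibre-unique v = Unique.filter⁺ (λ u → vis u Fin.≟ v) (Unique.allFin⁺ k)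

record CyclicOnFibres {k n : ℕ} (vis : Fin k → Fin n) (σ : Permutation′ k) : Set where
  field
    preserves  : ∀ u → vis (σ ⟨$⟩ʳ u) ≡ vis u
    transitive : ∀ u u′ → vis u ≡ vis u′ → Cycles._∼_ σ u u′

module Construction {k n : ℕ} (vis : Fin k → Fin n) (π₀ : Permutation′ k) where

  open Fibres vis

  faces : Permutation′ k → ℕ
  faces σ = cycleCount (π₀ ∘ₚ σ)

  -- Composition of permutations is definitionally associative, so this is Merge for π₀ ∘ₚ σ.
  faces-merge : ∀ σ {w y} → ¬ Cycles._∼_ (π₀ ∘ₚ σ) w y → faces σ ≡ suc (faces (σ ∘ₚ transpose w y))
  faces-merge σ = Merge.cycleCount-merge (π₀ ∘ₚ σ)

  data TranspositionEffect (σ : Permutation′ k) (w y : Fin k) : Set where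
    merges : faces σ ≡ suc (faces (σ ∘ₚ transpose w y)) → TranspositionEffect σ w y
    splits : faces (σ ∘ₚ transpose w y) ≡ suc (faces σ) →
             ¬ Cycles._∼_ (π₀ ∘ₚ σ ∘ₚ transpose w y) w y → TranspositionEffect σ w y

  transposition-effect : ∀ σ {w y} → w ≢ y → TranspositionEffect σ w y
  transposition-effect σ {w} {y} w≢y with Cycles._∼?_ (π₀ ∘ₚ σ) w y
  ... | no  w≁y = merges (faces-merge σ w≁y)
  ... | yes w∼y = splits (Split.cycleCount-split (π₀ ∘ₚ σ) w≢y w∼y)
                         (Split.separated (π₀ ∘ₚ σ) w≢y w∼y)

  faces-transpose-≤ : ∀ σ {w y} → w ≢ y → faces (σ ∘ₚ transpose w y) ≤ suc (faces σ)
  faces-transpose-≤ σ w≢y with transposition-effect σ w≢y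
  ... | merges e   = ℕ.≤-trans (ℕ.n≤1+n _) (ℕ.≤-trans (ℕ.n≤1+n _) (ℕ.≤-reflexive (cong suc (sym e))))
  ... | splits e _ = ℕ.≤-reflexive e

  module AtVertex (v : Fin n) (σ₀ : Permutation′ k) (s : Fin k) (vis-s : vis s ≡ v) where

    record Attaching (σ : Permutation′ k) (rest : List (Fin k)) : Set where
      open Cycles σ using (_∼_)
      field
        preserves   : ∀ u → vis (σ ⟨$⟩ʳ u) ≡ vis u
        elsewhere   : ∀ u → vis u ≢ v → σ ⟨$⟩ʳ u ≡ σ₀ ⟨$⟩ʳ u
        rest-fixed  : ∀ u → u ∈ rest → σ ⟨$⟩ʳ u ≡ u
        attached    : ∀ u → vis u ≡ v → u ∉ rest → s ∼ u
        s∉rest      : s ∉ rest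
        rest-unique : Unique rest
        rest-at-v   : All (λ u → vis u ≡ v) rest
    open Attaching

    -- Transposing w with a fixed point y inserts y into the cycle of w.
    attach : ∀ {σ y rest} → Attaching σ (y ∷ rest) → ∀ w → vis w ≡ v → w ∉ y ∷ rest → Cycles._∼_ σ s w →
             Attaching (σ ∘ₚ transpose w y) rest
    attach {σ} {y} {rest} A w vis-w w∉ s∼w = record
      { preserves   = preserves′
      ; elsewhere   = elsewhere′
      ; rest-fixed  = rest-fixed′
      ; attached    = attached′
      ; s∉rest      = s∉rest A ∘ there
      ; rest-unique = tail-unique
      ; rest-at-v   = All.tail (rest-at-v A) }
      where
      open Cycles σ
      vis-y : vis y ≡ v
      vis-y = All.head (rest-at-v A)
      y∉rest : All (y ≢_) rest
      tail-unique : Unique rest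
      y∉rest with rest-unique A
      ... | y∉ ∷ _ = y∉
      tail-unique with rest-unique A
      ... | _ ∷ u = u
      w≢y : w ≢ y
      w≢y w≡y = w∉ (here w≡y)
      w≁y : ¬ w ∼ y
      w≁y w∼y = let t , e = ∼-sym w∼y in w≢y (sym (trans (sym (iter-fixed (rest-fixed A y (here refl)) t)) e))
      module M = Merge σ w≁y
      open Cycles (σ ∘ₚ transpose w y) using () renaming (_∼_ to _∼′_; ∼-trans to ∼′-trans)
      τ : Fin k → Fin k
      τ = PC.transpose w y
      preserves′ : ∀ u → vis (τ (σ ⟨$⟩ʳ u)) ≡ vis u
      preserves′ u = trans (transpose-preserves vis (trans vis-w (sym vis-y)) (σ ⟨$⟩ʳ u)) (preserves A u)
      elsewhere′ : ∀ u → vis u ≢ v → τ (σ ⟨$⟩ʳ u) ≡ σ₀ ⟨$⟩ʳ u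
      elsewhere′ u vis-u≢v = trans (transpose-other (off-v vis-w) (off-v vis-y)) (elsewhere A u vis-u≢v)
        where off-v : ∀ {z} → vis z ≡ v → σ ⟨$⟩ʳ u ≢ z
              off-v vis-z σu≡z = vis-u≢v (trans (sym (preserves A u)) (trans (cong vis σu≡z) vis-z))
      rest-fixed′ : ∀ u → u ∈ rest → τ (σ ⟨$⟩ʳ u) ≡ u
      rest-fixed′ u u∈rest = trans (cong τ (rest-fixed A u (there u∈rest)))
        (transpose-other (λ u≡w → w∉ (there (subst (_∈ rest) u≡w u∈rest)))
                         (λ u≡y → All.lookup y∉rest u∈rest (sym u≡y)))
      s∼′w : s ∼′ w
      s∼′w = Cycles.∼-sym (σ ∘ₚ transpose w y) (M.Joined⇒x∼′ (inj₁ (∼-sym s∼w)))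
      attached′ : ∀ u → vis u ≡ v → u ∉ rest → s ∼′ u
      attached′ u vis-u u∉rest with u Fin.≟ y
      ... | yes refl = ∼′-trans s∼′w M.x∼′y
      ... | no  u≢y  = ∼′-trans s∼′w (M.Joined⇒x∼′ (inj₁ (∼-trans (∼-sym s∼w)
                         (attached A u vis-u λ { (here u≡y) → u≢y u≡y ; (there u∈) → u∉rest u∈ }))))

    attach-pair : ∀ {σ y z rest} → Attaching σ (y ∷ z ∷ rest) →
                  ∃ λ σ′ → Attaching σ′ rest × faces σ′ ≤ faces σ
    attach-pair {σ} {y} {z} {rest} A = after-y (transposition-effect σ s≢y)
      where
      s≢y : s ≢ y
      s≢y s≡y = s∉rest A (here s≡y)
      s≢z : s ≢ z
      s≢z s≡z = s∉rest A (there (here s≡z))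
      vis-y : vis y ≡ v
      vis-y = All.head (rest-at-v A)
      y∉ : y ∉ z ∷ rest
      y∉ y∈ with rest-unique A
      ... | y∉′ ∷ _ = All.lookup y∉′ y∈ refl
      σ₁ : Permutation′ k
      σ₁ = σ ∘ₚ transpose s y
      A₁ : Attaching σ₁ (z ∷ rest)
      A₁ = attach A s vis-s (s∉rest A) (Cycles.∼-refl σ)
      open Cycles (π₀ ∘ₚ σ₁) using (_∼?_; ∼-trans; ∼-sym)
      -- If attaching y split a face, one of the two ways of attaching z merges two faces again.
      after-y : TranspositionEffect σ s y → ∃ λ σ′ → Attaching σ′ rest × faces σ′ ≤ faces σ
      after-y (merges e) = σ₁ ∘ₚ transpose s z , attach A₁ s vis-s (s∉rest A₁) (Cycles.∼-refl σ₁) ,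
        ℕ.≤-trans (faces-transpose-≤ σ₁ s≢z) (ℕ.≤-reflexive (sym e))
      after-y (splits e s≁y) with s ∼? z
      ... | no  s≁z = σ₁ ∘ₚ transpose s z , attach A₁ s vis-s (s∉rest A₁) (Cycles.∼-refl σ₁) ,
        ℕ.≤-pred (ℕ.≤-reflexive (trans (sym (faces-merge σ₁ s≁z)) e))
      ... | yes s∼z = σ₁ ∘ₚ transpose y z , attach A₁ y vis-y y∉ (attached A₁ y vis-y y∉) ,
        ℕ.≤-pred (ℕ.≤-reflexive (trans (sym (faces-merge σ₁ y≁z)) e))
        where
        y≁z : ¬ Cycles._∼_ (π₀ ∘ₚ σ₁) y z
        y≁z y∼z = s≁y (∼-trans s∼z (∼-sym y∼z))

    -- Attaching two at a time costs nothing; a single leftover element, present exactly when the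
    -- fibre has even size, may add one face.
    attach-all : ∀ {σ} rest → Attaching σ rest →
                 ∃ λ σ′ → Attaching σ′ [] × faces σ′ ≤ faces σ + (if isEven (suc (length rest)) then 1 else 0)
    attach-all {σ} []           A = σ , A , ℕ.m≤m+n (faces σ) 0
    attach-all {σ} (y ∷ [])     A = σ ∘ₚ transpose s y , attach A s vis-s (s∉rest A) (Cycles.∼-refl σ) ,
      ℕ.≤-trans (faces-transpose-≤ σ λ s≡y → s∉rest A (here s≡y)) (ℕ.≤-reflexive (ℕ.+-comm 1 (faces σ)))
    attach-all (y ∷ z ∷ rest) A with attach-pair A
    ... | σ₂ , A₂ , σ₂≤ with attach-all rest A₂
    ...   | σ′ , A′ , σ′≤ = σ′ , A′ , ℕ.≤-trans σ′≤ (ℕ.+-monoˡ-≤ _ σ₂≤)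


  evenBelow : ℕ → ℕ
  evenBelow c = count (λ v → does (toℕ v ℕ.<? c) ∧ isEven (fibreSize v))

  record Stage (c : ℕ) : Set where
    field
      σ          : Permutation′ k
      preserves  : ∀ u → vis (σ ⟨$⟩ʳ u) ≡ vis u
      untouched  : ∀ u → c ≤ toℕ (vis u) → σ ⟨$⟩ʳ u ≡ u
      transitive : ∀ u u′ → toℕ (vis u) < c → vis u ≡ vis u′ → Cycles._∼_ σ u u′
      bound      : faces σ ≤ cycleCount π₀ + evenBelow c

  stage-zero : Stage 0
  stage-zero = record
    { σ          = id
    ; preserves  = λ _ → refl
    ; untouched  = λ _ _ → refl
    ; transitive = λ _ _ ()
    ; bound      = ℕ.≤-reflexive (trans (cycleCount-cong {π = π₀ ∘ₚ id} {ρ = π₀} λ _ → refl)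
                                        (sym (trans (cong (cycleCount π₀ +_) evenBelow-zero) (ℕ.+-identityʳ _)))) }
    where
    evenBelow-zero : evenBelow 0 ≡ 0
    evenBelow-zero = count-none {f = λ v → does (toℕ v ℕ.<? 0) ∧ isEven (fibreSize v)} λ _ → refl

  module NextStage {c : ℕ} (S : Stage c) (c<n : c < n) where
    open Stage S
    v : Fin n
    v = fromℕ< c<n
    v≡c : toℕ v ≡ c
    v≡c = Fin.toℕ-fromℕ< c<n

    evenBelow-suc : evenBelow (suc c) ≡ (if isEven (fibreSize v) then 1 else 0) + evenBelow c
    evenBelow-suc = count-below-suc (isEven ∘ fibreSize) v≡c

    above-c : ∀ {u} → suc c ≤ toℕ (vis u) → vis u ≢ v
    above-c c<u vis-u≡v = ℕ.<-irrefl (sym (trans (cong toℕ vis-u≡v) v≡c)) c<u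

    empty-fibre : fibre v ≡ [] → Stage (suc c)
    empty-fibre fibre≡[] = record
      { σ          = σ
      ; preserves  = preserves
      ; untouched  = λ u c<u → untouched u (ℕ.<⇒≤ c<u)
      ; transitive = λ u u′ u<1+c → transitive u u′ (<-suc-≢ v≡c u<1+c (not-in-empty fibre≡[]))
      ; bound      = ℕ.≤-trans bound (ℕ.+-monoʳ-≤ (cycleCount π₀)
                       (ℕ.≤-trans (ℕ.m≤n+m (evenBelow c) _) (ℕ.≤-reflexive (sym evenBelow-suc)))) }
      where
      not-in-empty : ∀ {u} → fibre v ≡ [] → vis u ≢ v
      not-in-empty fibre≡[] vis-u≡v with subst (_ ∈_) fibre≡[] (∈-fibre⁺ vis-u≡v)
      ... | ()

    module _ {s : Fin k} {rest : List (Fin k)} (fibre≡ : fibre v ≡ s ∷ rest) where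
      private
        in-fibre : ∀ {u} → u ∈ s ∷ rest → vis u ≡ v
        in-fibre u∈ = ∈-fibre⁻ (subst (_ ∈_) (sym fibre≡) u∈)

      open AtVertex v σ s (in-fibre (here refl))

      initial : Attaching σ rest
      initial = record
        { preserves   = preserves
        ; elsewhere   = λ _ _ → refl
        ; rest-fixed  = λ u u∈ → untouched u (ℕ.≤-reflexive (sym (trans (cong toℕ (in-fibre (there u∈))) v≡c)))
        ; attached    = λ u vis-u u∉ → only-s (subst (u ∈_) fibre≡ (∈-fibre⁺ vis-u)) u∉
        ; s∉rest      = s∉rest
        ; rest-unique = rest-unique
        ; rest-at-v   = All.tabulate (in-fibre ∘ there) }
        where
        s∉rest : s ∉ rest
        rest-unique : Unique rest
        s∉rest s∈ with subst Unique fibre≡ (fibre-unique v)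
        ... | s∉ ∷ _ = All.lookup s∉ s∈ refl
        rest-unique with subst Unique fibre≡ (fibre-unique v)
        ... | _ ∷ u = u
        only-s : ∀ {u} → u ∈ s ∷ rest → u ∉ rest → Cycles._∼_ σ s u
        only-s (here refl) _   = Cycles.∼-refl σ
        only-s (there u∈)  u∉ = contradiction u∈ u∉

      fibre-attached : Stage (suc c)
      fibre-attached with attach-all rest initial
      ... | σ′ , A′ , σ′≤ = record
        { σ          = σ′
        ; preserves  = Attaching.preserves A′
        ; untouched  = λ u c<u → trans (Attaching.elsewhere A′ u (above-c c<u)) (untouched u (ℕ.<⇒≤ c<u))
        ; transitive = transitive′
        ; bound      = bound′ }
        where
        agree : ∀ {u} → vis u ≢ v → ∀ j → (σ′ ^ j) u ≡ (σ ^ j) u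
        agree vis-u≢v zero    = refl
        agree {u} vis-u≢v (suc j) = trans (cong (σ′ ⟨$⟩ʳ_) (agree vis-u≢v j))
          (Attaching.elsewhere A′ _ λ vis≡v → vis-u≢v (trans (sym (iter-invariant vis preserves j u)) vis≡v))
        transitive′ : ∀ u u′ → toℕ (vis u) < suc c → vis u ≡ vis u′ → Cycles._∼_ σ′ u u′
        transitive′ u u′ u<1+c vis-u≡vis-u′ with vis u Fin.≟ v
        ... | yes vis-u≡v = Cycles.∼-trans σ′ (Cycles.∼-sym σ′ (Attaching.attached A′ u vis-u≡v λ ()))
                                                (Attaching.attached A′ u′ (trans (sym vis-u≡vis-u′) vis-u≡v) λ ())
        ... | no  vis-u≢v = let j , σʲu≡u′ = transitive u u′ (<-suc-≢ v≡c u<1+c vis-u≢v) vis-u≡vis-u′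
                            in j , trans (agree vis-u≢v j) σʲu≡u′
        bound′ : faces σ′ ≤ cycleCount π₀ + evenBelow (suc c)
        bound′ = begin
          faces σ′                          ≤⟨ σ′≤ ⟩
          faces σ + e                       ≤⟨ ℕ.+-monoˡ-≤ e bound ⟩
          cycleCount π₀ + evenBelow c + e   ≡⟨ ℕ.+-assoc (cycleCount π₀) (evenBelow c) e ⟩
          cycleCount π₀ + (evenBelow c + e) ≡⟨ cong (cycleCount π₀ +_) (ℕ.+-comm (evenBelow c) e) ⟩
          cycleCount π₀ + (e + evenBelow c) ≡⟨ cong (cycleCount π₀ +_) evenBelow-suc′ ⟨
          cycleCount π₀ + evenBelow (suc c) ∎
          where
          open ℕ.≤-Reasoning
          e : ℕ
          e = if isEven (suc (length rest)) then 1 else 0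
          evenBelow-suc′ : evenBelow (suc c) ≡ e + evenBelow c
          evenBelow-suc′ = trans evenBelow-suc
            (cong (λ l → (if isEven (length l) then 1 else 0) + evenBelow c) fibre≡)

    next-stage : Stage (suc c)
    next-stage with fibre v in fibre≡
    ... | []       = empty-fibre fibre≡
    ... | s ∷ rest = fibre-attached fibre≡

  stage : ∀ c → c ≤ n → Stage c
  stage zero    _   = stage-zero
  stage (suc c) c<n = NextStage.next-stage (stage c (ℕ.<⇒≤ c<n)) c<n

  fibre-rotation : ∃ λ σ → CyclicOnFibres vis σ × faces σ ≤ cycleCount π₀ + count (λ v → isEven (fibreSize v))
  fibre-rotation = σ , record { preserves = preserves ; transitive = λ u u′ → transitive u u′ (Fin.toℕ<n (vis u)) } ,
    ℕ.≤-trans bound (ℕ.≤-reflexive (cong (cycleCount π₀ +_) evenBelow-n))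
    where
    open Stage (stage n ℕ.≤-refl)
    evenBelow-n : evenBelow n ≡ count (λ v → isEven (fibreSize v))
    evenBelow-n = count-cong λ v → cong (_∧ isEven (fibreSize v)) (dec-true (toℕ v ℕ.<? n) (Fin.toℕ<n v))

-- Degrees and visits of an euler circuit

isEven-double : ∀ x → isEven x ≡ does ((x + x) % 4 ℕ.≟ 0)
isEven-double zero          = refl
isEven-double (suc zero)    = refl
isEven-double (suc (suc x)) = trans (isEven-double x) (cong (λ r → does (r ℕ.≟ 0)) (sym (begin
  (suc (suc x) + suc (suc x)) % 4 ≡⟨ cong (λ t → suc (suc t) % 4) (trans (ℕ.+-suc x (suc x)) (cong suc (ℕ.+-suc x x))) ⟩
  (4 + (x + x)) % 4               ≡⟨ cong (_% 4) (ℕ.+-comm 4 (x + x)) ⟩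
  (x + x + 4) % 4                 ≡⟨ [m+n]%n≡m%n (x + x) 4 ⟩
  (x + x) % 4                     ∎)))
  where open ≡-Reasoning

numDeg0mod4≡0 : (G : Graph) → AllDeg2mod4 G → numDeg0mod4 G ≡ 0
numDeg0mod4≡0 G deg≡2 = trans (length-filter-tabulate (λ v → deg G v % 4 ℕ.≟ 0) (λ v → v))
  (count-none λ v → cong (λ r → does (r ℕ.≟ 0)) (deg≡2 v))

module EulerCircuit {G : Graph} {T : Fin (m G) → Dart G} (eul : IsEulerCircuit G T) where
  open IsEulerCircuit eul

  edgeAt : Permutation′ (m G)
  edgeAt = Bijection⇒Inverse (mk⤖ everyEdgeOnce)

  visit : Fin (m G) → Fin (n G)
  visit i = head G (T i)

  open Fibres visit using (fibreSize)

  tail-T : ∀ i → tail G (T i) ≡ visit (cpred i)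
  tail-T i = sym (trans (closedWalk (cpred i)) (cong (tail G ∘ T) (csuc-cpred i)))

  deg-visits : ∀ v → deg G v ≡ fibreSize v + fibreSize v
  -- Reindexed along T, the two darts of the i-th edge leave visit (i - 1) and visit i,
  -- so every visit is counted twice.
  deg-visits v = begin
    deg G v                                      ≡⟨ deg-as-sums ⟩
    sum forward + sum backward                   ≡⟨ ∑-distrib-+ forward backward ⟨
    sum (λ e → forward e + backward e)           ≡⟨ sum-permute (λ e → forward e + backward e) edgeAt ⟩
    sum (λ i → forward (edge i) + backward (edge i)) ≡⟨ sum-cong-≗ (λ i → both-ends (T i)) ⟩
    sum (λ i → at (T i) + at (rev G (T i)))      ≡⟨ ∑-distrib-+ (at ∘ T) (at ∘ rev G ∘ T) ⟩
    sum (at ∘ T) + sum visits-at                 ≡⟨ cong (_+ sum visits-at) (sum-cong-≗ (cong at-vertex ∘ tail-T)) ⟩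
    sum (visits-at ∘ cpred) + sum visits-at      ≡⟨ cong (_+ sum visits-at) (sum-permute visits-at cpredₚ) ⟨
    sum visits-at + sum visits-at                ≡⟨ cong₂ _+_ fibreSize-sum fibreSize-sum ⟨
    fibreSize v + fibreSize v                    ∎
    where
    open ≡-Reasoning
    edge : Fin (m G) → Fin (m G)
    edge i = proj₁ (T i)
    at-vertex : Fin (n G) → ℕ
    at-vertex w = if does (w Fin.≟ v) then 1 else 0
    at : Dart G → ℕ
    at d = at-vertex (tail G d)
    forward backward : Fin (m G) → ℕ
    forward e  = at (e , false)
    backward e = at (e , true)
    visits-at : Fin (m G) → ℕ
    visits-at i = at-vertex (visit i)
    both-ends : ∀ d → forward (proj₁ d) + backward (proj₁ d) ≡ at d + at (rev G d)
    both-ends (e , false) = refl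
    both-ends (e , true)  = ℕ.+-comm (forward e) (backward e)
    from-v? : ∀ d → Dec (tail G d ≡ v)
    from-v? d = tail G d Fin.≟ v
    darts : Bool → List (Dart G)
    darts b = map (_, b) (allFin (m G))
    darts-at : ∀ b → length (filter from-v? (darts b)) ≡ sum (λ e → at (e , b))
    darts-at b = trans (cong (length ∘ filter from-v?) (List.map-tabulate (λ e → e) (_, b)))
                       (length-filter-tabulate from-v? (_, b))
    deg-as-sums : deg G v ≡ sum forward + sum backward
    deg-as-sums = begin
      length (filter from-v? (darts false ++ darts true))                   ≡⟨ cong length (List.filter-++ from-v? (darts false) (darts true)) ⟩
      length (filter from-v? (darts false) ++ filter from-v? (darts true))  ≡⟨ List.length-++ (filter from-v? (darts false)) ⟩
      length (filter from-v? (darts false)) + length (filter from-v? (darts true)) ≡⟨ cong₂ _+_ (darts-at false) (darts-at true) ⟩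
      sum forward + sum backward                                            ∎
    fibreSize-sum : fibreSize v ≡ sum visits-at
    fibreSize-sum = length-filter-tabulate (λ u → visit u Fin.≟ v) (λ i → i)

  numDeg0mod4-visits : numDeg0mod4 G ≡ count (λ v → isEven (fibreSize v))
  numDeg0mod4-visits = trans (length-filter-tabulate (λ v → deg G v % 4 ℕ.≟ 0) (λ v → v))
    (count-cong λ v → trans (cong (λ d → does (d % 4 ℕ.≟ 0)) (deg-visits v)) (sym (isEven-double (fibreSize v))))

-- The embedding

head-φ : ∀ {G} (R : RotationSystem G) d → head G d ≡ tail G (φ R d)
head-φ {G} R d = sym (ρ-local R (rev G d))

module Embedding {G : Graph} {T : Fin (m G) → Dart G} (eul : IsEulerCircuit G T)
                 (σ : Permutation′ (m G)) (cyclic : CyclicOnFibres (EulerCircuit.visit eul) σ) where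

  open EulerCircuit eul
  open CyclicOnFibres cyclic

  -- Position (i , false) stands for the dart T i and (i , true) for its reverse.
  Position : Set
  Position = Fin (m G) × Bool

  direction : Fin (m G) → Bool
  direction i = proj₂ (T i)

  dartAt : Position → Dart G
  dartAt (i , b) = proj₁ (T i) , b xor direction i

  positionOf : Dart G → Position
  positionOf (e , b) = edgeAt ⟨$⟩ˡ e , b xor direction (edgeAt ⟨$⟩ˡ e)

  xor-cancelʳ : ∀ b d → (b xor d) xor d ≡ b
  xor-cancelʳ b d = trans (xor-assoc b d d) (trans (cong (b xor_) (xor-same d)) (xor-identityʳ b))

  dartAt-positionOf : ∀ d → dartAt (positionOf d) ≡ d
  dartAt-positionOf (e , b) = cong₂ _,_ (inverseʳ edgeAt) (xor-cancelʳ b _)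

  positionOf-dartAt : ∀ c → positionOf (dartAt c) ≡ c
  positionOf-dartAt (i , b) rewrite inverseˡ edgeAt {i} = cong (i ,_) (xor-cancelʳ b (direction i))

  darts : Position ↔ Dart G
  darts = mk↔ₛ′ dartAt positionOf dartAt-positionOf positionOf-dartAt

  rev-dartAt : ∀ i b → rev G (dartAt (i , b)) ≡ dartAt (i , not b)
  rev-dartAt i b = cong (proj₁ (T i) ,_) (not-distribˡ-xor b (direction i))

  -- T bounds a face because the reverse of T i is followed by T (i + 1); σ chooses the rest.
  rotate : Position → Position
  rotate (i , true)  = csuc i , false
  rotate (i , false) = σ ⟨$⟩ʳ cpred i , true

  unrotate : Position → Position
  unrotate (i , false) = cpred i , true
  unrotate (i , true)  = csuc (σ ⟨$⟩ˡ i) , false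

  rotations : Position ↔ Position
  rotations = mk↔ₛ′ rotate unrotate rotate-unrotate unrotate-rotate
    where
    rotate-unrotate : ∀ c → rotate (unrotate c) ≡ c
    rotate-unrotate (i , false) = cong (_, false) (csuc-cpred i)
    rotate-unrotate (i , true)  = cong (_, true) (trans (cong (σ ⟨$⟩ʳ_) (cpred-csuc (σ ⟨$⟩ˡ i))) (inverseʳ σ))
    unrotate-rotate : ∀ c → unrotate (rotate c) ≡ c
    unrotate-rotate (i , true)  = cong (_, true) (cpred-csuc i)
    unrotate-rotate (i , false) = cong (_, false) (trans (cong csuc (inverseˡ σ)) (csuc-cpred i))

  vertexAt : Position → Fin (n G)
  vertexAt (i , false) = visit (cpred i)
  vertexAt (i , true)  = visit i

  tail-dartAt : ∀ c → tail G (dartAt c) ≡ vertexAt c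
  tail-dartAt (i , false) = tail-T i
  tail-dartAt (i , true)  = refl

  vertexAt-rotate : ∀ c → vertexAt (rotate c) ≡ vertexAt c
  vertexAt-rotate (i , true)  = cong visit (cpred-csuc i)
  vertexAt-rotate (i , false) = preserves (cpred i)

  rotate-twice : ∀ j i → iter rotate (j + j) (i , true) ≡ ((σ ^ j) i , true)
  rotate-twice zero    i = refl
  rotate-twice (suc j) i = begin
    iter rotate (suc j + suc j) (i , true)        ≡⟨ cong (λ t → iter rotate t (i , true)) (cong suc (ℕ.+-suc j j)) ⟩
    rotate (rotate (iter rotate (j + j) (i , true))) ≡⟨ cong (rotate ∘ rotate) (rotate-twice j i) ⟩
    (σ ⟨$⟩ʳ cpred (csuc ((σ ^ j) i)) , true)      ≡⟨ cong (λ u → σ ⟨$⟩ʳ u , true) (cpred-csuc _) ⟩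
    ((σ ^ suc j) i , true)                        ∎
    where open ≡-Reasoning

  rotate-transitive-from-reversed : ∀ i c′ → visit i ≡ vertexAt c′ → ∃ λ t → iter rotate t (i , true) ≡ c′
  rotate-transitive-from-reversed i (i′ , true) visit≡ with transitive i i′ visit≡
  ... | j , σʲi≡i′ = j + j , trans (rotate-twice j i) (cong (_, true) σʲi≡i′)
  rotate-transitive-from-reversed i (i′ , false) visit≡ with rotate-transitive-from-reversed i (cpred i′ , true) visit≡
  ... | t , e = suc t , trans (cong rotate e) (cong (_, false) (csuc-cpred i′))

  rotate-transitive : ∀ c c′ → vertexAt c ≡ vertexAt c′ → ∃ λ t → iter rotate t c ≡ c′
  rotate-transitive (i , true)  c′ visit≡ = rotate-transitive-from-reversed i c′ visit≡
  rotate-transitive (i , false) c′ visit≡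
    with rotate-transitive-from-reversed (σ ⟨$⟩ʳ cpred i) c′ (trans (vertexAt-rotate (i , false)) visit≡)
  ... | t , e = t + 1 , trans (iter-+ rotate t 1 (i , false)) e

  rotateᴰ : Dart G → Dart G
  rotateᴰ = dartAt ∘ rotate ∘ positionOf

  iter-rotateᴰ : ∀ t c → iter rotateᴰ t (dartAt c) ≡ dartAt (iter rotate t c)
  iter-rotateᴰ t c = sym (iter-natural dartAt (λ c → sym (cong (dartAt ∘ rotate) (positionOf-dartAt c))) t c)

  R : RotationSystem G
  R = record
    { ρ        = rotateᴰ
    ; ρ-bij    = Bijection.bijective (↔⇒⤖ (darts ↔-∘ (rotations ↔-∘ ↔-sym darts)))
    ; ρ-local  = λ d → begin
        tail G (rotateᴰ d)                 ≡⟨ tail-dartAt (rotate (positionOf d)) ⟩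
        vertexAt (rotate (positionOf d))   ≡⟨ vertexAt-rotate (positionOf d) ⟩
        vertexAt (positionOf d)            ≡⟨ tail-dartAt (positionOf d) ⟨
        tail G (dartAt (positionOf d))     ≡⟨ cong (tail G) (dartAt-positionOf d) ⟩
        tail G d                           ∎
    ; ρ-cyclic = λ d d′ tail≡ →
        let t , e = rotate-transitive (positionOf d) (positionOf d′) (at-position {d} {d′} tail≡)
        in t , (begin
          iter rotateᴰ t d                            ≡⟨ cong (iter rotateᴰ t) (dartAt-positionOf d) ⟨
          iter rotateᴰ t (dartAt (positionOf d))      ≡⟨ iter-rotateᴰ t (positionOf d) ⟩
          dartAt (iter rotate t (positionOf d))       ≡⟨ cong dartAt e ⟩
          dartAt (positionOf d′)                      ≡⟨ dartAt-positionOf d′ ⟩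
          d′                                          ∎) }
    where
    open ≡-Reasoning
    vertexAt-positionOf : ∀ d → vertexAt (positionOf d) ≡ tail G d
    vertexAt-positionOf d = trans (sym (tail-dartAt (positionOf d))) (cong (tail G) (dartAt-positionOf d))
    at-position : ∀ {d d′} → tail G d ≡ tail G d′ → vertexAt (positionOf d) ≡ vertexAt (positionOf d′)
    at-position {d} {d′} tail≡ = trans (vertexAt-positionOf d) (trans tail≡ (sym (vertexAt-positionOf d′)))

  ψ : Permutation′ (m G)
  ψ = cpredₚ ∘ₚ σ

  -- Faces run along T forwards and along the cycles of ψ backwards.
  faceStep : Position → Position
  faceStep (i , false) = csuc i , false
  faceStep (i , true)  = ψ ⟨$⟩ʳ i , true

  φ-dartAt : ∀ c → φ R (dartAt c) ≡ dartAt (faceStep c)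
  φ-dartAt (i , false) = cong (dartAt ∘ rotate) (trans (cong positionOf (rev-dartAt i false)) (positionOf-dartAt (i , true)))
  φ-dartAt (i , true)  = cong (dartAt ∘ rotate) (trans (cong positionOf (rev-dartAt i true)) (positionOf-dartAt (i , false)))

  iter-φ : ∀ t c → iter (φ R) t (dartAt c) ≡ dartAt (iter faceStep t c)
  iter-φ t c = sym (iter-natural dartAt (λ c → sym (φ-dartAt c)) t c)

  iter-faceStep-forward : ∀ t i → iter faceStep t (i , false) ≡ (i ⊕ t , false)
  iter-faceStep-forward t i = trans (sym (iter-natural (_, false) (λ _ → refl) t i)) (cong (_, false) (iter-csuc i t))

  iter-faceStep-reversed : ∀ t i → iter faceStep t (i , true) ≡ ((ψ ^ t) i , true)
  iter-faceStep-reversed t i = sym (iter-natural (_, true) (λ _ → refl) t i)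

  iter-faceStep-direction : ∀ t c → proj₂ (iter faceStep t c) ≡ proj₂ c
  iter-faceStep-direction t (i , false) = cong proj₂ (iter-faceStep-forward t i)
  iter-faceStep-direction t (i , true)  = cong proj₂ (iter-faceStep-reversed t i)

  sameFace-positions : ∀ {c c′} → SameFace R (dartAt c) (dartAt c′) → ∃ λ t → iter faceStep t c ≡ c′
  sameFace-positions {c} {c′} (t , e) = t , (begin
    iter faceStep t c                       ≡⟨ positionOf-dartAt _ ⟨
    positionOf (dartAt (iter faceStep t c)) ≡⟨ cong positionOf (trans (sym (iter-φ t c)) e) ⟩
    positionOf (dartAt c′)                  ≡⟨ positionOf-dartAt c′ ⟩
    c′                                      ∎)
    where open ≡-Reasoning

  T-face : ∀ s → Traces R (T s) T
  T-face s = s , λ t → trans (iter-φ t (s , false)) (cong dartAt (iter-faceStep-forward t s))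

  sameFace-forward : ∀ {z} → toℕ z ≡ 0 → ∀ i → SameFace R (T z) (T i)
  sameFace-forward {z} z≡0 i = toℕ i , trans (proj₂ (T-face z) (toℕ i)) (cong T (⊕-toℕ z≡0 i))

  sameFace-reversed : ∀ {a b} → Cycles._∼_ ψ a b → SameFace R (dartAt (a , true)) (dartAt (b , true))
  sameFace-reversed {a} (t , ψᵗa≡b) = t , trans (iter-φ t (a , true))
    (cong dartAt (trans (iter-faceStep-reversed t a) (cong (_, true) ψᵗa≡b)))

  sameFace-reversed⁻¹ : ∀ {a b} → SameFace R (dartAt (a , true)) (dartAt (b , true)) → Cycles._∼_ ψ a b
  sameFace-reversed⁻¹ {a} same with sameFace-positions same
  ... | t , e = t , cong proj₁ (trans (sym (iter-faceStep-reversed t a)) e)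

  sameFace-direction : ∀ {i j b b′} → SameFace R (dartAt (i , b)) (dartAt (j , b′)) → b ≡ b′
  sameFace-direction {i} {b = b} same with sameFace-positions same
  ... | t , e = trans (sym (iter-faceStep-direction t (i , b))) (cong proj₂ e)

  sameFace-or-reversed : ∀ {z} → toℕ z ≡ 0 → ∀ d → SameFace R (T z) d ⊎ ∃ λ i → dartAt (i , true) ≡ d
  sameFace-or-reversed z≡0 d with positionOf d in pos
  ... | i , false = inj₁ (subst (SameFace R _) (trans (cong dartAt (sym pos)) (dartAt-positionOf d)) (sameFace-forward z≡0 i))
  ... | i , true  = inj₂ (i , trans (cong dartAt (sym pos)) (dartAt-positionOf d))

  -- One face is bounded by T; the others are indexed by the least elements of the cycles of ψ.
  hasFaces : ∀ {z} → toℕ z ≡ 0 → HasFaces R (suc (cycleCount ψ))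
  hasFaces {z} z≡0 = face , covers , distinct
    where
    open Cycles ψ
    open Enumeration (enumerate (λ u → does (isLeast? u)))
    face : Fin (suc (cycleCount ψ)) → Dart G
    face Fin.zero    = T z
    face (Fin.suc j) = dartAt (at j , true)
    covers : ∀ d → ∃ λ j → SameFace R (face j) d
    covers d with sameFace-or-reversed z≡0 d
    ... | inj₁ same       = Fin.zero , same
    ... | inj₂ (i , refl) =
      let u , u-least , u∼i = least-of-cycle i
          j , at-j≡u        = at-onto u (dec-true (isLeast? u) u-least)
      in Fin.suc j , subst (λ w → SameFace R (dartAt (w , true)) (dartAt (i , true))) (sym at-j≡u) (sameFace-reversed u∼i)
    distinct : ∀ j j′ → SameFace R (face j) (face j′) → j ≡ j′
    distinct Fin.zero    Fin.zero     _    = refl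
    distinct Fin.zero    (Fin.suc j′) same = contradiction (sameFace-direction {z} {at j′} {false} {true} same) λ ()
    distinct (Fin.suc j) Fin.zero     same = contradiction (sameFace-direction {at j} {z} {true} {false} same) λ ()
    distinct (Fin.suc j) (Fin.suc j′) same = cong Fin.suc (at-injective
      (least-unique (does-true (isLeast? (at j)) (at-true j)) (does-true (isLeast? (at j′)) (at-true j′))
                    (sameFace-reversed⁻¹ same)))

  module SingleBackwardFace (connected : ∀ a b → Cycles._∼_ ψ a b) {z : Fin (m G)} (z≡0 : toℕ z ≡ 0) where
    open Cycles ψ using (^-periodic; module SingleCycle)
    open SingleCycle connected z
    instance _ = Fin.nonZeroIndex z

    W : Fin (m G) → Dart G
    W i = dartAt ((ψ ^ toℕ i) z , true)

    W-at : ∀ t → W (z ⊕ t) ≡ dartAt ((ψ ^ t) z , true)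
    W-at t = cong (λ s → dartAt (s , true)) (begin
      (ψ ^ toℕ (z ⊕ t)) z      ≡⟨ cong (λ s → (ψ ^ s) z) (trans (toℕ-⊕ z t) (cong (λ r → (r + t) ℕ.% m G) z≡0)) ⟩
      (ψ ^ (t ℕ.% m G)) z        ≡⟨ ^-periodic period t ⟨
      (ψ ^ t) z                ∎)
      where open ≡-Reasoning

    W-face : Traces R (dartAt (z , true)) W
    W-face = z , λ t → trans (iter-φ t (z , true)) (trans (cong dartAt (iter-faceStep-reversed t z)) (sym (W-at t)))

    W-step : ∀ i → W (csuc i) ≡ φ R (W i)
    W-step i = begin
      W (csuc i)                                ≡⟨ cong (W ∘ csuc) (⊕-toℕ z≡0 i) ⟨
      W ((z ⊕ toℕ i) ⊕ 1)                       ≡⟨ cong W (⊕-+ z (toℕ i) 1) ⟩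
      W (z ⊕ (toℕ i + 1))                       ≡⟨ W-at (toℕ i + 1) ⟩
      dartAt ((ψ ^ (toℕ i + 1)) z , true)       ≡⟨ cong (λ s → dartAt ((ψ ^ s) z , true)) (ℕ.+-comm (toℕ i) 1) ⟩
      dartAt (faceStep ((ψ ^ toℕ i) z , true))  ≡⟨ φ-dartAt ((ψ ^ toℕ i) z , true) ⟨
      φ R (W i)                                 ∎
      where open ≡-Reasoning

    W-euler : IsEulerCircuit G W
    W-euler = record
      { closedWalk    = λ i → trans (head-φ R (W i)) (cong (tail G) (sym (W-step i)))
      ; everyEdgeOnce = edge-injective , edge-onto
      ; everyVertex   = vertex-onto }
      where
      edge-injective : ∀ {i j} → proj₁ (W i) ≡ proj₁ (W j) → i ≡ j
      edge-injective e = injective (Injection.injective (↔⇒↣ edgeAt) e)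
      edge-onto : ∀ e → ∃ λ i → ∀ {j} → j ≡ i → proj₁ (W j) ≡ e
      edge-onto e = let i , ψⁱz≡ = onto (edgeAt ⟨$⟩ˡ e)
                    in i , λ { refl → trans (cong (edgeAt ⟨$⟩ʳ_) ψⁱz≡) (inverseʳ edgeAt) }
      vertex-onto : ∀ v → ∃ λ i → tail G (W i) ≡ v
      vertex-onto v = let i₀ , tail≡v = IsEulerCircuit.everyVertex eul v
                          i , ψⁱz≡ = onto (cpred i₀)
                      in i , trans (cong visit ψⁱz≡) (trans (sym (tail-T i₀)) tail≡v)

    biEulerian : BiEulerian R
    biEulerian = face , covers , distinct , bounded
      where
      face : Fin 2 → Dart G
      face Fin.zero       = T z
      face (Fin.suc _)    = dartAt (z , true)
      covers : ∀ d → ∃ λ j → SameFace R (face j) d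
      covers d with sameFace-or-reversed z≡0 d
      ... | inj₁ same       = Fin.zero , same
      ... | inj₂ (i , refl) = Fin.suc Fin.zero , sameFace-reversed (connected z i)
      distinct : ∀ j j′ → SameFace R (face j) (face j′) → j ≡ j′
      distinct Fin.zero                Fin.zero                _    = refl
      distinct Fin.zero                (Fin.suc Fin.zero)      same = contradiction (sameFace-direction {z} {z} {false} {true} same) λ ()
      distinct (Fin.suc Fin.zero)      Fin.zero                same = contradiction (sameFace-direction {z} {z} {true} {false} same) λ ()
      distinct (Fin.suc Fin.zero)      (Fin.suc Fin.zero)      _    = refl
      bounded : ∀ j → ∃ λ W′ → IsEulerCircuit G W′ × FaceBoundedBy R (face j) W′
      bounded Fin.zero           = T , eul , inj₁ (T-face z)
      bounded (Fin.suc Fin.zero) = W , W-euler , inj₁ W-face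

module _ {G : Graph} {T : Fin (m G) → Dart G} (eul : IsEulerCircuit G T) where
  open EulerCircuit eul

  visit-rotation : ∃ λ σ → CyclicOnFibres visit σ × cycleCount (cpredₚ ∘ₚ σ) ≤ 1 + numDeg0mod4 G
  visit-rotation with Construction.fibre-rotation visit cpredₚ
  ... | σ , cyclic , bound =
    σ , cyclic , ℕ.≤-trans bound (ℕ.+-mono-≤ cpred-cycles≤1 (ℕ.≤-reflexive (sym numDeg0mod4-visits)))
    where
    cpred-cycles≤1 : cycleCount (cpredₚ {m G}) ≤ 1
    cpred-cycles≤1 = Cycles.connected⇒cycles≤1 cpredₚ (cpred-connected {m G})

corollary4p7 : (G : Graph) (T : Fin (m G) → Dart G) → IsEulerCircuit G T →
    1 ≤ m G → (ℓ : ℕ) → numDeg0mod4 G ≡ ℓ →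
    Σ (RotationSystem G) λ R →
      (∃ λ d → FaceBoundedBy R d T) ×
      (∃ λ N → N ≤ ℓ + 2 × HasFaces R N) ×
      (AllDeg2mod4 G → BiEulerian R)
corollary4p7 G T eul 1≤m .(numDeg0mod4 G) refl with visit-rotation eul
... | σ , cyclic , ψ-cycles≤ =
  R , (T z , inj₁ (T-face z)) , (suc (cycleCount ψ) , faces≤ , hasFaces z≡0) , bi-eulerian
  where
  open Embedding eul σ cyclic
  z : Fin (m G)
  z = fromℕ< 1≤m
  z≡0 : toℕ z ≡ 0
  z≡0 = Fin.toℕ-fromℕ< 1≤m
  faces≤ : suc (cycleCount ψ) ≤ numDeg0mod4 G + 2
  faces≤ = ℕ.≤-trans (ℕ.s≤s ψ-cycles≤) (ℕ.≤-reflexive (ℕ.+-comm 2 (numDeg0mod4 G)))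
  bi-eulerian : AllDeg2mod4 G → BiEulerian R
  bi-eulerian deg≡2 = SingleBackwardFace.biEulerian
    (Cycles.cycles≤1⇒connected ψ (subst (λ l → cycleCount ψ ≤ 1 + l) (numDeg0mod4≡0 G deg≡2) ψ-cycles≤)) z≡0
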